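{- Let $m,n>1$ be integers, and let $C_n+\overline{K}_m$ be the $(m,n)$-cone, where $C_n$ is a cycle of length $n$. Then the sparing number of $C_n+\overline{K}_m$ is $n$.
   Context: All graphs are simple and finite. For non-empty $A,B\subseteq\mathbb{N}_0$, the sum set is $A+B=\{a+b:a\in A,b\in B\}$. An integer additive set-indexer (IASI) of a graph $G$ is an injective map $f:V(G)\to\mathcal{P}(\mathbb{N}_0)$ such that the induced map $f^+:E(G)\to\mathcal{P}(\mathbb{N}_0)$, $f^+(uv)=f(u)+f(v)$, is also injective. The set-indexing number of a vertex or edge is the cardinality of its label. An IASI $f$ is a weak IASI if $|f^+(uv)|=\max(|f(u)|,|f(v)|)$ for every edge $uv$. An element (vertex or edge) with set-indexing number $1$ is mono-indexed. The sparing number $\varphi(G)$ of $G$ is the minimum number of mono-indexed edges required for $G$ to admit a weak IASI. The join $G_1+G_2$ has vertex set $V(G_1)\cup V(G_2)$ and edge set $E(G_1)\cup E(G_2)\cup\{uv:u\in V(G_1),v\in V(G_2)\}$. $\overline{K}_m$ is the edgeless graph on $m$ vertices. -}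

module Defs where

open import Data.Nat using (ℕ; zero; suc; _+_; _≤_; _<_; _⊔_; _≟_; _<ᵇ_; _≡ᵇ_)
open import Data.Nat.Properties using () renaming (_≟_ to _≟ℕ_)
open import Data.Bool using (Bool; true; false; _∧_; _∨_; not; T)
open import Data.Fin using (Fin; toℕ)
open import Data.List using (List; []; _∷_; length; map; concatMap; filter; deduplicate; allFin; cartesianProduct)
open import Data.List.Membership.Propositional using (_∈_)
open import Data.Product using (_×_; _,_; Σ; proj₁; proj₂)
open import Relation.Binary.PropositionalEquality using (_≡_; _≢_)
open import Relation.Nullary using (Dec)
open import Relation.Nullary.Decidable using (_×-dec_)
open import Data.Bool.Properties using (T?)

-- Finite subsets of ℕ₀, represented by lists (set semantics).

_≈ₛ_ : List ℕ → List ℕ → Set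
A ≈ₛ B = ∀ x → (x ∈ A → x ∈ B) × (x ∈ B → x ∈ A)

card : List ℕ → ℕ
card A = length (deduplicate _≟_ A)

_⊕_ : List ℕ → List ℕ → List ℕ
A ⊕ B = concatMap (λ a → map (a +_) B) A

-- Finite simple graphs on vertex set Fin N, given by a Boolean adjacency.
-- Edges are the unordered pairs {u,v}, represented canonically as (u , v)
-- with toℕ u < toℕ v and adj u v = true.

record Graph : Set where
  field
    N   : ℕ
    adj : Fin N → Fin N → Bool

open Graph public

Edge : Graph → Set
Edge G = Fin (N G) × Fin (N G)

isEdge : (G : Graph) → Edge G → Bool
isEdge G (u , v) = (toℕ u <ᵇ toℕ v) ∧ adj G u v

edges : (G : Graph) → List (Edge G)
edges G = filter (λ e → T? (isEdge G e)) (cartesianProduct (allFin (N G)) (allFin (N G)))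

Labelling : Graph → Set
Labelling G = Fin (N G) → List ℕ

sumLabel : (G : Graph) → Labelling G → Edge G → List ℕ
sumLabel G f (u , v) = f u ⊕ f v

record IsIASI (G : Graph) (f : Labelling G) : Set where
  field
    nonempty  : ∀ v → f v ≢ []
    injective : ∀ u v → f u ≈ₛ f v → u ≡ v
    edgeInjective : ∀ e e' → e ∈ edges G → e' ∈ edges G → sumLabel G f e ≈ₛ sumLabel G f e' → e ≡ e'

record IsWeakIASI (G : Graph) (f : Labelling G) : Set where
  field
    iasi : IsIASI G f
    weak : ∀ u v → (u , v) ∈ edges G → card (f u ⊕ f v) ≡ card (f u) ⊔ card (f v)

monoCount : (G : Graph) → Labelling G → ℕ
monoCount G f = length (filter (λ e → card (sumLabel G f e) ≟ 1) (edges G))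

IsSparingNumber : Graph → ℕ → Set
IsSparingNumber G k =
  Σ (Labelling G) (λ f → IsWeakIASI G f × monoCount G f ≡ k)
  × (∀ f → IsWeakIASI G f → k ≤ monoCount G f)

-- The (m,n)-cone C_n + K̄_m on vertices 0 … n+m-1:
-- vertices 0 … n-1 form the cycle C_n (i ~ i+1, and n-1 ~ 0),
-- vertices n … n+m-1 form K̄_m, joined to every cycle vertex.

cycleAdjℕ : ℕ → ℕ → ℕ → Bool
cycleAdjℕ n i j = (suc i ≡ᵇ j) ∨ (suc j ≡ᵇ i) ∨ ((i ≡ᵇ 0) ∧ (suc j ≡ᵇ n)) ∨ ((j ≡ᵇ 0) ∧ (suc i ≡ᵇ n))

coneAdjℕ : ℕ → ℕ → ℕ → Bool
coneAdjℕ n i j =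
  ((i <ᵇ n) ∧ (j <ᵇ n) ∧ cycleAdjℕ n i j)
  ∨ ((i <ᵇ n) ∧ not (j <ᵇ n))
  ∨ (not (i <ᵇ n) ∧ (j <ᵇ n))

cone : (m n : ℕ) → Graph
cone m n = record { N = n + m ; adj = λ u v → coneAdjℕ n (toℕ u) (toℕ v) }

-- If |B| ≥ 2 and lo < hi lie in B, the sums a + lo (a ∈ A) together with max A + hi are |A| + 1
-- distinct elements of A + B. So in a weak IASI no edge joins two vertices with labels of size
-- at least 2, and an edge between two mono-indexed vertices is mono-indexed.
--
-- If some hub (vertex of K̄_m) is not mono-indexed, every cycle vertex is, and so are
-- the n cycle edges (distinct since n > 2). Otherwise two hubs h₀, h₁ are mono-indexed, and each
-- cycle vertex a is charged the mono-indexed spoke a h₀ if a is mono-indexed, and else the spoke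
-- a⁺ h₁, where the successor a⁺ of a on the cycle must then be mono-indexed; distinct vertices are
-- charged distinct spokes.
--
-- Label the cycle vertices by singletons and the hubs by sets {0, d} with distinct
-- large d. Cycle edges then get singletons and spokes two-element sets, so exactly the n cycle
-- edges are mono-indexed; all vertex and edge labels are told apart by their least and greatest
-- elements.
module Submission where

open import Defs
open import Data.Bool using (true; false; T)
open import Data.Bool.Properties using (T?; T-∧; ∨-identityʳ)
open import Data.Fin using (Fin; toℕ; fromℕ<)
import Data.Fin.Properties as Fin
open import Data.List using (List; []; _∷_; length; map; filter; deduplicate; lookup; allFin; cartesianProduct; upTo)
open import Data.List.Properties using (length-map; length-tabulate; length-upTo)
open import Data.List.Extrema.Nat using (max; min; xs≤max; ⊥≤max; argmax-sel; max≈v⁺; min≈v⁺; max-mono-⊆; min-mono-⊆)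
open import Data.List.Membership.Propositional using (_∈_)
open import Data.List.Membership.Propositional.Properties
  using (∈-lookup; ∈-map⁺; ∈-map⁻; ∈-concatMap⁺; ∈-deduplicate⁺; ∈-deduplicate⁻; ∈-filter⁺; ∈-filter⁻;
         ∈-cartesianProduct⁺; ∈-allFin; ∈-upTo⁺)
open import Data.List.Relation.Binary.Subset.Propositional using (_⊆_)
open import Data.List.Relation.Unary.All as All using (All; []; _∷_)
open import Data.List.Relation.Unary.AllPairs using (_∷_)
open import Data.List.Relation.Unary.Any as Any using (here; there)
open import Data.List.Relation.Unary.Any.Properties using (lookup-index)
open import Data.List.Relation.Unary.Unique.Propositional using (Unique)
import Data.List.Relation.Unary.Unique.Propositional.Properties as Unique
open import Data.List.Relation.Unary.Unique.DecPropositional.Properties using (deduplicate-!)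
open import Data.Nat using (ℕ; zero; suc; _+_; _≤_; _<_; _⊔_; _≟_; _<?_; _<ᵇ_; _≡ᵇ_; z≤n; s≤s; z<s; s<s⁻¹)
open import Data.Nat.Properties
open import Data.Product using (_×_; _,_; ∃; ∃₂; proj₁; proj₂)
open import Data.Product.Properties using (,-injectiveˡ; ,-injectiveʳ)
open import Data.Sum as Sum using (_⊎_; inj₁; inj₂)
open import Function using (_∘_)
open import Function.Bundles using (Equivalence)
open import Function.Definitions using (Injective)
open import Relation.Binary.Definitions using (tri<; tri≈; tri>)
open import Relation.Binary.PropositionalEquality
open import Relation.Nullary using (¬_; ¬?; Dec; yes; no; contradiction)
open import Relation.Nullary.Reflects using (Reflects; ofʸ; ofⁿ; fromEquivalence)

lookup-injective : ∀ {A : Set} {xs : List A} → Unique xs → Injective _≡_ _≡_ (lookup xs)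
lookup-injective {xs = _ ∷ _} (_ ∷ _) {Fin.zero} {Fin.zero} _ = refl
lookup-injective {xs = _ ∷ _} (x∉xs ∷ _) {Fin.zero} {Fin.suc j} eq = contradiction eq (All.lookup x∉xs (∈-lookup j))
lookup-injective {xs = _ ∷ _} (x∉xs ∷ _) {Fin.suc i} {Fin.zero} eq = contradiction (sym eq) (All.lookup x∉xs (∈-lookup i))
lookup-injective {xs = _ ∷ _} (_ ∷ u) {Fin.suc i} {Fin.suc j} eq = cong Fin.suc (lookup-injective u eq)

⊆⇒length≤ : ∀ {A : Set} {xs ys : List A} → Unique xs → xs ⊆ ys → length xs ≤ length ys
⊆⇒length≤ {xs = xs} {ys} u xs⊆ys = Fin.injective⇒≤ {f = λ i → Any.index (xs⊆ys (∈-lookup i))} λ {i} {j} eq →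
  lookup-injective u (trans (lookup-index (xs⊆ys (∈-lookup i)))
                       (trans (cong (lookup ys) eq) (sym (lookup-index (xs⊆ys (∈-lookup j))))))

injective⇒≤length : ∀ {A : Set} {k} {ys : List A} (g : Fin k → A) →
  Injective _≡_ _≡_ g → (∀ i → g i ∈ ys) → k ≤ length ys
injective⇒≤length {k = k} {ys} g g-injective g∈ys = begin
  k                         ≡⟨ trans (length-map g (allFin k)) (length-tabulate (λ i → i)) ⟨
  length (map g (allFin k)) ≤⟨ ⊆⇒length≤ (Unique.map⁺ g-injective (Unique.allFin⁺ k)) image⊆ys ⟩
  length ys                 ∎
  where
  open ≤-Reasoning
  image⊆ys : map g (allFin k) ⊆ ys
  image⊆ys z∈ with ∈-map⁻ g z∈
  ... | i , _ , refl = g∈ys i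

-- Sum sets and weak IASIs

Mono : List ℕ → Set
Mono A = card A ≡ 1

mono⊎2≤card : ∀ A → A ≢ [] → Mono A ⊎ 2 ≤ card A
mono⊎2≤card [] A≢[] = contradiction refl A≢[]
mono⊎2≤card (x ∷ A) _ with length (filter (¬? ∘ (x ≟_)) (deduplicate _≟_ A))
... | zero = inj₁ refl
... | suc _ = inj₂ (s≤s (s≤s z≤n))

2≤card⇒ordered-pair : ∀ B → 2 ≤ card B → ∃₂ λ lo hi → lo < hi × lo ∈ B × hi ∈ B
2≤card⇒ordered-pair B 2≤∣B∣ = go (deduplicate _≟_ B) (deduplicate-! _≟_ B) (∈-deduplicate⁻ _≟_ B) 2≤∣B∣
  where
  go : ∀ D → Unique D → D ⊆ B → 2 ≤ length D → ∃₂ λ lo hi → lo < hi × lo ∈ B × hi ∈ B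
  go (_ ∷ []) _ _ (s≤s ())
  go (p ∷ q ∷ _) ((p≢q ∷ _) ∷ _) D⊆B _ with <-cmp p q
  ... | tri< p<q _ _ = p , q , p<q , D⊆B (here refl) , D⊆B (there (here refl))
  ... | tri≈ _ p≡q _ = contradiction p≡q p≢q
  ... | tri> _ _ q<p = q , p , q<p , D⊆B (there (here refl)) , D⊆B (here refl)

1+card≤card-of-sums : ∀ X Y S → X ≢ [] → 2 ≤ card Y →
  (∀ {x y} → x ∈ X → y ∈ Y → x + y ∈ S) → suc (card X) ≤ card S
1+card≤card-of-sums [] _ _ X≢[] _ _ = contradiction refl X≢[]
1+card≤card-of-sums X@(x₀ ∷ X′) Y S _ 2≤∣Y∣ sums∈S with 2≤card⇒ordered-pair Y 2≤∣Y∣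
... | lo , hi , lo<hi , lo∈Y , hi∈Y =
  subst (_≤ card S) (cong suc (length-map (_+ lo) D)) (⊆⇒length≤ unique sums⊆S)
  where
  D = deduplicate _≟_ X
  M = max x₀ X′

  ≤M : ∀ {x} → x ∈ X → x ≤ M
  ≤M (here refl) = ⊥≤max x₀ X′
  ≤M (there x∈X′) = All.lookup (xs≤max x₀ X′) x∈X′

  M∈X : M ∈ X
  M∈X with argmax-sel (λ x → x) x₀ X′
  ... | inj₁ M≡x₀ = here M≡x₀
  ... | inj₂ M∈X′ = there M∈X′

  unique : Unique (M + hi ∷ map (_+ lo) D)
  unique = All.tabulate M+hi-new ∷ Unique.map⁺ (λ {a} {b} → +-cancelʳ-≡ lo a b) (deduplicate-! _≟_ X)
    where
    M+hi-new : ∀ {z} → z ∈ map (_+ lo) D → M + hi ≢ z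
    M+hi-new z∈ with ∈-map⁻ (_+ lo) z∈
    ... | x , x∈D , refl = >⇒≢ (+-mono-≤-< (≤M (∈-deduplicate⁻ _≟_ X x∈D)) lo<hi)

  sums⊆S : M + hi ∷ map (_+ lo) D ⊆ deduplicate _≟_ S
  sums⊆S (here refl) = ∈-deduplicate⁺ _≟_ (sums∈S M∈X hi∈Y)
  sums⊆S (there z∈) with ∈-map⁻ (_+ lo) z∈
  ... | x , x∈D , refl = ∈-deduplicate⁺ _≟_ (sums∈S (∈-deduplicate⁻ _≟_ X x∈D) lo∈Y)

∈-⊕ : ∀ {x y} A B → x ∈ A → y ∈ B → x + y ∈ A ⊕ B
∈-⊕ {x} A B x∈A y∈B = ∈-concatMap⁺ (λ a → map (a +_) B) (Any.map (λ { refl → ∈-map⁺ (x +_) y∈B }) x∈A)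

weak-sum⇒mono : ∀ A B → A ≢ [] → B ≢ [] → card (A ⊕ B) ≡ card A ⊔ card B → Mono A ⊎ Mono B
weak-sum⇒mono A B A≢[] B≢[] weak with mono⊎2≤card A A≢[] | mono⊎2≤card B B≢[]
... | inj₁ mono-A | _ = inj₁ mono-A
... | inj₂ _ | inj₁ mono-B = inj₂ mono-B
... | inj₂ 2≤∣A∣ | inj₂ 2≤∣B∣ = contradiction weak (>⇒≢ (⊔-lub A<A⊕B B<A⊕B))
  where
  A<A⊕B = 1+card≤card-of-sums A B (A ⊕ B) A≢[] 2≤∣B∣ (∈-⊕ A B)
  B<A⊕B = 1+card≤card-of-sums B A (A ⊕ B) B≢[] 2≤∣A∣
            λ {y} {x} y∈B x∈A → subst (_∈ A ⊕ B) (+-comm x y) (∈-⊕ A B x∈A y∈B)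

monoEdges : (G : Graph) → Labelling G → List (Edge G)
monoEdges G f = filter (λ e → card (sumLabel G f e) ≟ 1) (edges G)

edges-unique : ∀ G → Unique (edges G)
edges-unique G = Unique.filter⁺ _ (Unique.cartesianProduct⁺ (Unique.allFin⁺ (N G)) (Unique.allFin⁺ (N G)))

module _ {G : Graph} {f : Labelling G} (weakIASI : IsWeakIASI G f) where
  open IsWeakIASI weakIASI
  open IsIASI iasi

  weak⇒mono-endpoint : ∀ {u v} → (u , v) ∈ edges G → Mono (f u) ⊎ Mono (f v)
  weak⇒mono-endpoint {u} {v} uv∈E = weak-sum⇒mono (f u) (f v) (nonempty u) (nonempty v) (weak u v uv∈E)

  mono-endpoints⇒∈monoEdges : ∀ {u v} → (u , v) ∈ edges G → Mono (f u) → Mono (f v) → (u , v) ∈ monoEdges G f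
  mono-endpoints⇒∈monoEdges {u} {v} uv∈E mono-u mono-v =
    ∈-filter⁺ (λ e → card (sumLabel G f e) ≟ 1) uv∈E (trans (weak u v uv∈E) (cong₂ _⊔_ mono-u mono-v))

-- Edges of the cone

data CycleEdge : ℕ → ℕ × ℕ → Set where
  path : ∀ {n a} → suc a < n → CycleEdge n (a , suc a)
  wrap : ∀ {b} → 0 < b → CycleEdge (suc b) (0 , b)

data ConeEdge (n : ℕ) : ℕ × ℕ → Set where
  cycle : ∀ {e} → CycleEdge n e → ConeEdge n e
  spoke : ∀ {a b} → a < n → n ≤ b → ConeEdge n (a , b)

cycleEdge-bounded : ∀ {n a b} → CycleEdge n (a , b) → a < b × b < n
cycleEdge-bounded (path a+1<n) = n<1+n _ , a+1<n
cycleEdge-bounded (wrap 0<b) = 0<b , n<1+n _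

cycleEdge-endpoints<n : ∀ {n a b} → CycleEdge n (a , b) → a < n × b < n
cycleEdge-endpoints<n c = let a<b , b<n = cycleEdge-bounded c in <-trans a<b b<n , b<n

coneEdge-ordered : ∀ {n a b} → ConeEdge n (a , b) → a < b
coneEdge-ordered (cycle c) = proj₁ (cycleEdge-bounded c)
coneEdge-ordered (spoke a<n n≤b) = <-≤-trans a<n n≤b

coneEdge-source<n : ∀ {n a b} → ConeEdge n (a , b) → a < n
coneEdge-source<n (cycle c) = proj₁ (cycleEdge-endpoints<n c)
coneEdge-source<n (spoke a<n _) = a<n

≡ᵇ-reflects-≡ : ∀ m n → Reflects (m ≡ n) (m ≡ᵇ n)
≡ᵇ-reflects-≡ m n = fromEquivalence (≡ᵇ⇒≡ m n) (≡⇒≡ᵇ m n)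

-- In the omitted clauses adj has type T false.
cycleAdj⁻ : ∀ {n a b} → a < b → b < n → T (cycleAdjℕ n a b) → CycleEdge n (a , b)
cycleAdj⁻ {n} {a} {b} a<b b<n adj with suc a ≡ᵇ b | ≡ᵇ-reflects-≡ (suc a) b
... | true | ofʸ refl = path b<n
... | false | _ with suc b ≡ᵇ a | ≡ᵇ-reflects-≡ (suc b) a
...   | true | ofʸ refl = contradiction a<b (<-asym (n<1+n b))
cycleAdj⁻ {n} {zero} {suc b} a<b b<n adj | false | _ | false | _
  with suc (suc b) ≡ᵇ n | ≡ᵇ-reflects-≡ (suc (suc b)) n
... | true | ofʸ refl = wrap a<b

cycleAdj⁺ : ∀ {n a b} → CycleEdge n (a , b) → T (cycleAdjℕ n a b)
cycleAdj⁺ {a = a} (path _) with a ≡ᵇ a | ≡⇒≡ᵇ a a refl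
... | true | _ = _
cycleAdj⁺ {b = b} (wrap _) with 1 ≡ᵇ b | b ≡ᵇ b | ≡⇒≡ᵇ b b refl
... | true | _ | _ = _
... | false | true | _ = _

coneAdj⁻ : ∀ {n a b} → a < b → T (coneAdjℕ n a b) → ConeEdge n (a , b)
coneAdj⁻ {n} {a} {b} a<b adj with a <ᵇ n | <ᵇ-reflects-< a n | b <ᵇ n | <ᵇ-reflects-< b n
... | true  | ofʸ a<n | true  | ofʸ b<n = cycle (cycleAdj⁻ a<b b<n (subst T (∨-identityʳ _) adj))
... | true  | ofʸ a<n | false | ofⁿ b≮n = spoke a<n (≮⇒≥ b≮n)
... | false | ofⁿ a≮n | true  | ofʸ b<n = contradiction (<-trans a<b b<n) a≮n

coneAdj⁺ : ∀ {n a b} → ConeEdge n (a , b) → T (coneAdjℕ n a b)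
coneAdj⁺ {n} {a} {b} e with a <ᵇ n | <ᵇ-reflects-< a n | b <ᵇ n | <ᵇ-reflects-< b n | e
... | true  | _ | true  | _ | cycle c = subst T (sym (∨-identityʳ _)) (cycleAdj⁺ c)
... | true  | _ | true  | ofʸ b<n | spoke _ n≤b = contradiction b<n (≤⇒≯ n≤b)
... | true  | _ | false | _ | spoke _ _ = _
... | true  | _ | false | ofⁿ b≮n | cycle c = contradiction (proj₂ (cycleEdge-bounded c)) b≮n
... | false | ofⁿ a≮n | _ | _ | _ = contradiction (coneEdge-source<n e) a≮n

∈-edges-cone⁻ : ∀ {m n} {u v : Fin (n + m)} → (u , v) ∈ edges (cone m n) → ConeEdge n (toℕ u , toℕ v)
∈-edges-cone⁻ {m} {n} {u} {v} uv∈E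
  with Equivalence.to (T-∧ {toℕ u <ᵇ toℕ v})
         (proj₂ (∈-filter⁻ (T? ∘ isEdge (cone m n)) {xs = cartesianProduct (allFin (n + m)) (allFin (n + m))} uv∈E))
... | u<v , adj = coneAdj⁻ (<ᵇ⇒< (toℕ u) (toℕ v) u<v) adj

∈-edges-cone⁺ : ∀ {m n} {u v : Fin (n + m)} → ConeEdge n (toℕ u , toℕ v) → (u , v) ∈ edges (cone m n)
∈-edges-cone⁺ {m} {n} {u} {v} e =
  ∈-filter⁺ (T? ∘ isEdge (cone m n)) (∈-cartesianProduct⁺ (∈-allFin u) (∈-allFin v))
    (Equivalence.from (T-∧ {toℕ u <ᵇ toℕ v}) (<⇒<ᵇ (coneEdge-ordered e) , coneAdj⁺ e))

toℕ² : ∀ {k} → Fin k × Fin k → ℕ × ℕ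
toℕ² (u , v) = toℕ u , toℕ v

toℕ²-injective : ∀ {k} → Injective _≡_ _≡_ (toℕ² {k})
toℕ²-injective {x = _ , _} {_ , _} eq =
  cong₂ _,_ (Fin.toℕ-injective (,-injectiveˡ eq)) (Fin.toℕ-injective (,-injectiveʳ eq))

module ConeVertices (m n : ℕ) where

  ∈-edges-cone⁺′ : ∀ {a b} → ConeEdge n (a , b) → .(a<N : a < n + m) .(b<N : b < n + m) →
    (fromℕ< a<N , fromℕ< b<N) ∈ edges (cone m n)
  ∈-edges-cone⁺′ e a<N b<N =
    ∈-edges-cone⁺ (subst₂ (λ x y → ConeEdge n (x , y)) (sym (Fin.toℕ-fromℕ< a<N)) (sym (Fin.toℕ-fromℕ< b<N)) e)

  cyc : (a : ℕ) → .(a < n) → Fin (n + m)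
  cyc a a<n = fromℕ< (<-≤-trans a<n (m≤m+n n m))

  hub : (k : ℕ) → .(k < m) → Fin (n + m)
  hub k k<m = fromℕ< (+-monoʳ-< n k<m)

  cyc-injective : ∀ {a b} .(a<n : a < n) .(b<n : b < n) → cyc a a<n ≡ cyc b b<n → a ≡ b
  cyc-injective _ _ eq = trans (sym (Fin.toℕ-fromℕ< _)) (trans (cong toℕ eq) (Fin.toℕ-fromℕ< _))

  hub-injective : ∀ {k l} .(k<m : k < m) .(l<m : l < m) → hub k k<m ≡ hub l l<m → k ≡ l
  hub-injective _ _ eq = +-cancelˡ-≡ n _ _ (trans (sym (Fin.toℕ-fromℕ< _)) (trans (cong toℕ eq) (Fin.toℕ-fromℕ< _)))

  cycle-edge : ∀ {a b} → CycleEdge n (a , b) → .(a<n : a < n) .(b<n : b < n) → (cyc a a<n , cyc b b<n) ∈ edges (cone m n)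
  cycle-edge c _ _ = ∈-edges-cone⁺′ (cycle c) _ _

  spoke-edge : ∀ {a k} (a<n : a < n) .(k<m : k < m) → (cyc a a<n , hub k k<m) ∈ edges (cone m n)
  spoke-edge {k = k} a<n _ = ∈-edges-cone⁺′ (spoke a<n (m≤m+n n k)) _ _

  liftCycleEdge : ∀ {e} → CycleEdge n e → Fin (n + m) × Fin (n + m)
  liftCycleEdge {a , b} c = let a<n , b<n = cycleEdge-endpoints<n c in cyc a a<n , cyc b b<n

  toℕ²-liftCycleEdge : ∀ {e} (c : CycleEdge n e) → toℕ² (liftCycleEdge c) ≡ e
  toℕ²-liftCycleEdge c = cong₂ _,_ (Fin.toℕ-fromℕ< _) (Fin.toℕ-fromℕ< _)

last-vertex : ∀ {n a} → a < n → ¬ suc a < n → suc a ≡ n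
last-vertex a<n a+1≮n = ≤-antisym a<n (≮⇒≥ a+1≮n)

next : ℕ → ℕ → ℕ
next n a with suc a <? n
... | yes _ = suc a
... | no _ = 0

edgeToNext : ℕ → ℕ → ℕ × ℕ
edgeToNext n a with suc a <? n
... | yes _ = a , suc a
... | no _ = 0 , a

next<n : ∀ {n a} → a < n → next n a < n
next<n {n} {a} a<n with suc a <? n
... | yes a+1<n = a+1<n
... | no _ = <-≤-trans z<s a<n

next-injective : ∀ {n a b} → a < n → b < n → next n a ≡ next n b → a ≡ b
next-injective {n} {a} {b} a<n b<n eq with suc a <? n | suc b <? n
... | yes _ | yes _ = suc-injective eq
... | no a+1≮n | no b+1≮n = suc-injective (trans (last-vertex a<n a+1≮n) (sym (last-vertex b<n b+1≮n)))

next-adjacent : ∀ {n a} → 1 < n → a < n → CycleEdge n (a , next n a) ⊎ CycleEdge n (next n a , a)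
next-adjacent {n} {a} 1<n a<n with suc a <? n
... | yes a+1<n = inj₁ (path a+1<n)
... | no a+1≮n with last-vertex a<n a+1≮n
...   | refl = inj₂ (wrap (s<s⁻¹ 1<n))

edgeToNext-cycleEdge : ∀ {n a} → 1 < n → a < n → CycleEdge n (edgeToNext n a)
edgeToNext-cycleEdge {n} {a} 1<n a<n with suc a <? n
... | yes a+1<n = path a+1<n
... | no a+1≮n with last-vertex a<n a+1≮n
...   | refl = wrap (s<s⁻¹ 1<n)

edgeToNext-injective : ∀ {n a b} → 2 < n → a < n → b < n → edgeToNext n a ≡ edgeToNext n b → a ≡ b
edgeToNext-injective {n} {a} {b} 2<n a<n b<n eq with suc a <? n | suc b <? n
... | yes _ | yes _ = cong proj₁ eq
... | no _ | no _ = cong proj₂ eq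
... | yes _ | no b+1≮n with eq
...   | refl = contradiction (last-vertex b<n b+1≮n) (<⇒≢ 2<n)
edgeToNext-injective {n} {a} {b} 2<n a<n b<n eq | no a+1≮n | yes _ with eq
...   | refl = contradiction (last-vertex a<n a+1≮n) (<⇒≢ 2<n)

edgeToNext-path : ∀ {n a} → suc a < n → edgeToNext n a ≡ (a , suc a)
edgeToNext-path {n} {a} a+1<n with suc a <? n
... | yes _ = refl
... | no a+1≮n = contradiction a+1<n a+1≮n

edgeToNext-wrap : ∀ b → edgeToNext (suc b) b ≡ (0 , b)
edgeToNext-wrap b with suc b <? suc b
... | yes b+1<b+1 = contradiction b+1<b+1 (<-irrefl refl)
... | no _ = refl

cycleEdge⇒edgeToNext : ∀ {n e} → CycleEdge n e → ∃ λ a → a < n × edgeToNext n a ≡ e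
cycleEdge⇒edgeToNext (path {a = a} a+1<n) = a , <-trans (n<1+n a) a+1<n , edgeToNext-path a+1<n
cycleEdge⇒edgeToNext (wrap {b} _) = b , n<1+n b , edgeToNext-wrap b

-- A weak IASI with n mono-indexed edges

-- max 0 A bounds A from above, so it serves as the default of min.
bounds : List ℕ → ℕ × ℕ
bounds A = min (max 0 A) A , max 0 A

bounds-cong : ∀ {A B} → A ≈ₛ B → bounds A ≡ bounds B
bounds-cong {A} {B} A≈B = cong₂ _,_ min-eq max-eq
  where
  A⊆B = λ {x} → proj₁ (A≈B x)
  B⊆A = λ {x} → proj₂ (A≈B x)
  max-eq : max 0 A ≡ max 0 B
  max-eq = ≤-antisym (max-mono-⊆ ≤-refl A⊆B) (max-mono-⊆ ≤-refl B⊆A)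
  min-eq : min (max 0 A) A ≡ min (max 0 B) B
  min-eq = ≤-antisym (min-mono-⊆ (≤-reflexive max-eq) B⊆A) (min-mono-⊆ (≤-reflexive (sym max-eq)) A⊆B)

bounds-transport : ∀ {A B x y} → A ≈ₛ B → bounds A ≡ x → bounds B ≡ y → x ≡ y
bounds-transport A≈B bA bB = trans (sym bA) (trans (bounds-cong A≈B) bB)

bounds-of : ∀ A {lo hi} → lo ∈ A → hi ∈ A → All (lo ≤_) A → All (_≤ hi) A → bounds A ≡ (lo , hi)
bounds-of A lo∈A hi∈A lo≤A A≤hi =
  cong₂ _,_ (trans (cong (λ t → min t A) max≡hi) (min≈v⁺ lo∈A lo≤A (All.lookup A≤hi lo∈A))) max≡hi
  where
  max≡hi = max≈v⁺ hi∈A A≤hi z≤n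

bounds-singleton : ∀ x → bounds (x ∷ []) ≡ (x , x)
bounds-singleton x = bounds-of (x ∷ []) (here refl) (here refl) (≤-refl ∷ []) (≤-refl ∷ [])

bounds-pair : ∀ x y → x ≤ y → bounds (x ∷ y ∷ []) ≡ (x , y)
bounds-pair x y x≤y =
  bounds-of (x ∷ y ∷ []) (here refl) (there (here refl)) (≤-refl ∷ x≤y ∷ []) (x≤y ∷ ≤-refl ∷ [])

-- card (x ∷ y ∷ []) only reduces once x ≡ᵇ y, the test underlying x ≟ y, is known.
card-pair : ∀ {x y} → x ≢ y → card (x ∷ y ∷ []) ≡ 2
card-pair {x} {y} x≢y with x ≡ᵇ y in x≡ᵇy
... | true = contradiction (≡ᵇ⇒≡ x y (subst T (sym x≡ᵇy) _)) x≢y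
... | false = refl

-- The last cycle vertex is raised to 2n: with cycleValue n a = a throughout, the sum n - 1 of the
-- wrap edge would coincide with the sum 2a + 1 of a path edge whenever n is even.
cycleValue : ℕ → ℕ → ℕ
cycleValue n a with suc a ≟ n
... | yes _ = n + n
... | no _ = a

hubValue : ℕ → ℕ → ℕ
hubValue n b = suc (n + n + b)

coneLabel : ℕ → ℕ → List ℕ
coneLabel n a with a <? n
... | yes _ = cycleValue n a ∷ []
... | no _ = 0 ∷ hubValue n a ∷ []

edgeLabel : ℕ → ℕ × ℕ → List ℕ
edgeLabel n e = coneLabel n (proj₁ e) ⊕ coneLabel n (proj₂ e)

cycleValue-last : ∀ a → cycleValue (suc a) a ≡ suc a + suc a
cycleValue-last a with suc a ≟ suc a
... | yes _ = refl
... | no a+1≢a+1 = contradiction refl a+1≢a+1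

cycleValue-inner : ∀ {n a} → suc a < n → cycleValue n a ≡ a
cycleValue-inner {n} {a} a+1<n with suc a ≟ n
... | yes a+1≡n = contradiction a+1≡n (<⇒≢ a+1<n)
... | no _ = refl

cycleValue≤ : ∀ {n a} → a < n → cycleValue n a ≤ n + n
cycleValue≤ {n} {a} a<n with suc a ≟ n
... | yes _ = ≤-refl
... | no _ = ≤-trans (<⇒≤ a<n) (m≤m+n n n)

cycleValue-injective : ∀ {n a b} → a < n → b < n → cycleValue n a ≡ cycleValue n b → a ≡ b
cycleValue-injective {n} {a} {b} a<n b<n eq with suc a ≟ n | suc b ≟ n
... | yes a+1≡n | yes b+1≡n = suc-injective (trans a+1≡n (sym b+1≡n))
... | no _ | no _ = eq
... | yes _ | no _ = contradiction (sym eq) (<⇒≢ (<-≤-trans b<n (m≤m+n n n)))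
... | no _ | yes _ = contradiction eq (<⇒≢ (<-≤-trans a<n (m≤m+n n n)))

cycleValue<hubValue : ∀ {n a} b → a < n → cycleValue n a < hubValue n b
cycleValue<hubValue b a<n = s≤s (≤-trans (cycleValue≤ a<n) (m≤m+n _ b))

hubValue-injective : ∀ {n a b} → hubValue n a ≡ hubValue n b → a ≡ b
hubValue-injective {n} eq = +-cancelˡ-≡ (n + n) _ _ (suc-injective eq)

cycleSum : ℕ → ℕ × ℕ → ℕ
cycleSum n (a , b) = cycleValue n a + cycleValue n b

cycleSum-view : ∀ {n a b} → CycleEdge n (a , b) →
  (b ≡ suc a × suc b < n × cycleSum n (a , b) ≡ a + suc a) ⊎ (suc b ≡ n × cycleSum n (a , b) ≡ a + (n + n))
cycleSum-view {n} (path {a = a} a+1<n) with suc (suc a) <? n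
... | yes a+2<n = inj₁ (refl , a+2<n , cong₂ _+_ (cycleValue-inner a+1<n) (cycleValue-inner a+2<n))
... | no a+2≮n with ≤-antisym a+1<n (≮⇒≥ a+2≮n)
...   | refl = inj₂ (refl , cong₂ _+_ (cycleValue-inner a+1<n) (cycleValue-last (suc a)))
cycleSum-view (wrap {b} 0<b) = inj₂ (refl , cong₂ _+_ (cycleValue-inner (s≤s 0<b)) (cycleValue-last b))

a+1+a-injective : ∀ {a b} → a + suc a ≡ b + suc b → a ≡ b
a+1+a-injective {a} {b} eq with <-cmp a b
... | tri< a<b _ _ = contradiction eq (<⇒≢ (+-mono-< a<b (s≤s a<b)))
... | tri≈ _ a≡b _ = a≡b
... | tri> _ _ b<a = contradiction eq (>⇒≢ (+-mono-< b<a (s≤s b<a)))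

inner<last : ∀ {n a a′} → suc (suc a) < n → a + suc a < a′ + (n + n)
inner<last {n} {a} {a′} a+2<n = <-≤-trans (+-mono-< (<-trans (n<1+n a) a+1<n) a+1<n) (m≤n+m (n + n) a′)
  where a+1<n = <-trans (n<1+n (suc a)) a+2<n

cycleSum-injective : ∀ {n a b a′ b′} → CycleEdge n (a , b) → CycleEdge n (a′ , b′) →
  cycleSum n (a , b) ≡ cycleSum n (a′ , b′) → (a , b) ≡ (a′ , b′)
cycleSum-injective {n} {a} {b} {a′} {b′} c c′ eq with cycleSum-view c | cycleSum-view c′
... | inj₁ (refl , _ , s) | inj₁ (refl , _ , s′) with a+1+a-injective (trans (sym s) (trans eq s′))
...   | refl = refl
cycleSum-injective {n} {a} {b} {a′} {b′} c c′ eq | inj₂ (b+1≡n , s) | inj₂ (b′+1≡n , s′)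
  with +-cancelʳ-≡ (n + n) a a′ (trans (sym s) (trans eq s′)) | suc-injective (trans b+1≡n (sym b′+1≡n))
...   | refl | refl = refl
cycleSum-injective {n} {a} {b} {a′} {b′} c c′ eq | inj₁ (refl , a+2<n , s) | inj₂ (_ , s′) =
  contradiction (trans (sym s) (trans eq s′)) (<⇒≢ (inner<last {a′ = a′} a+2<n))
cycleSum-injective {n} {a} {b} {a′} {b′} c c′ eq | inj₂ (_ , s) | inj₁ (refl , a′+2<n , s′) =
  contradiction (trans (sym s′) (trans (sym eq) s)) (<⇒≢ (inner<last {a′ = a} a′+2<n))

coneLabel-cycle : ∀ {n a} → a < n → coneLabel n a ≡ cycleValue n a ∷ []
coneLabel-cycle {n} {a} a<n with a <? n
... | yes _ = refl
... | no a≮n = contradiction a<n a≮n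

coneLabel-hub : ∀ {n a} → n ≤ a → coneLabel n a ≡ 0 ∷ hubValue n a ∷ []
coneLabel-hub {n} {a} n≤a with a <? n
... | yes a<n = contradiction a<n (≤⇒≯ n≤a)
... | no _ = refl

coneLabel-nonempty : ∀ n a → coneLabel n a ≢ []
coneLabel-nonempty n a with a <? n
... | yes _ = λ ()
... | no _ = λ ()

bounds-coneLabel : ∀ n a → (a < n × bounds (coneLabel n a) ≡ (cycleValue n a , cycleValue n a))
                           ⊎ (n ≤ a × bounds (coneLabel n a) ≡ (0 , hubValue n a))
bounds-coneLabel n a with a <? n
... | yes a<n = inj₁ (a<n , bounds-singleton (cycleValue n a))
... | no a≮n = inj₂ (≮⇒≥ a≮n , bounds-pair 0 (hubValue n a) z≤n)

coneLabel-injective : ∀ n a b → coneLabel n a ≈ₛ coneLabel n b → a ≡ b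
coneLabel-injective n a b a≈b with bounds-coneLabel n a | bounds-coneLabel n b
... | inj₁ (a<n , ba) | inj₁ (b<n , bb) = cycleValue-injective a<n b<n (,-injectiveˡ (bounds-transport a≈b ba bb))
... | inj₂ (_ , ba) | inj₂ (_ , bb) = hubValue-injective {n} (,-injectiveʳ (bounds-transport a≈b ba bb))
... | inj₁ (a<n , ba) | inj₂ (_ , bb) =
  contradiction (,-injectiveʳ (bounds-transport a≈b ba bb)) (<⇒≢ (cycleValue<hubValue b a<n))
... | inj₂ (_ , ba) | inj₁ (b<n , bb) =
  contradiction (sym (,-injectiveʳ (bounds-transport a≈b ba bb))) (<⇒≢ (cycleValue<hubValue a b<n))

edgeLabel-cycle : ∀ {n a b} → CycleEdge n (a , b) → edgeLabel n (a , b) ≡ cycleSum n (a , b) ∷ []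
edgeLabel-cycle c with cycleEdge-endpoints<n c
... | a<n , b<n rewrite coneLabel-cycle a<n | coneLabel-cycle b<n = refl

edgeLabel-spoke : ∀ {n a b} → a < n → n ≤ b →
  edgeLabel n (a , b) ≡ cycleValue n a ∷ cycleValue n a + hubValue n b ∷ []
edgeLabel-spoke {n} {a} a<n n≤b rewrite coneLabel-cycle a<n | coneLabel-hub n≤b | +-identityʳ (cycleValue n a) = refl

card-edgeLabel-spoke : ∀ {n a b} → a < n → n ≤ b → card (edgeLabel n (a , b)) ≡ 2
card-edgeLabel-spoke {n} {a} a<n n≤b rewrite edgeLabel-spoke a<n n≤b = card-pair (m+1+n≢m (cycleValue n a) ∘ sym)

edgeLabel-weak : ∀ {n a b} → ConeEdge n (a , b) → card (edgeLabel n (a , b)) ≡ card (coneLabel n a) ⊔ card (coneLabel n b)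
edgeLabel-weak (cycle c) with cycleEdge-endpoints<n c
... | a<n , b<n rewrite coneLabel-cycle a<n | coneLabel-cycle b<n = refl
edgeLabel-weak (spoke a<n n≤b) rewrite card-edgeLabel-spoke a<n n≤b | coneLabel-cycle a<n | coneLabel-hub n≤b = refl

mono-edgeLabel⇒cycleEdge : ∀ {n a b} → ConeEdge n (a , b) → Mono (edgeLabel n (a , b)) → CycleEdge n (a , b)
mono-edgeLabel⇒cycleEdge (cycle c) _ = c
mono-edgeLabel⇒cycleEdge (spoke a<n n≤b) mono = contradiction (trans (sym (card-edgeLabel-spoke a<n n≤b)) mono) λ ()

edgeCode : ∀ {n a b} → ConeEdge n (a , b) → ℕ × ℕ
edgeCode {n} {a} {b} (cycle _) = cycleSum n (a , b) , cycleSum n (a , b)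
edgeCode {n} {a} {b} (spoke _ _) = cycleValue n a , cycleValue n a + hubValue n b

bounds-edgeLabel : ∀ {n a b} (e : ConeEdge n (a , b)) → bounds (edgeLabel n (a , b)) ≡ edgeCode e
bounds-edgeLabel {n} {a} {b} (cycle c) =
  trans (cong bounds (edgeLabel-cycle c)) (bounds-singleton (cycleSum n (a , b)))
bounds-edgeLabel {n} {a} {b} (spoke a<n n≤b) =
  trans (cong bounds (edgeLabel-spoke a<n n≤b))
        (bounds-pair (cycleValue n a) (cycleValue n a + hubValue n b) (m≤m+n (cycleValue n a) (hubValue n b)))

edgeCode-injective : ∀ {n a b a′ b′} (e : ConeEdge n (a , b)) (e′ : ConeEdge n (a′ , b′)) →
  edgeCode e ≡ edgeCode e′ → (a , b) ≡ (a′ , b′)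
edgeCode-injective (cycle c) (cycle c′) eq = cycleSum-injective c c′ (,-injectiveˡ eq)
edgeCode-injective {n} (spoke a<n _) (spoke a′<n _) eq with cycleValue-injective a<n a′<n (,-injectiveˡ eq)
... | refl = cong (_ ,_) (hubValue-injective {n} (+-cancelˡ-≡ _ _ _ (,-injectiveʳ eq)))
edgeCode-injective (cycle _) (spoke _ _) eq = contradiction (trans (sym (,-injectiveˡ eq)) (,-injectiveʳ eq)) (m+1+n≢m _ ∘ sym)
edgeCode-injective (spoke _ _) (cycle _) eq = contradiction (trans (,-injectiveˡ eq) (sym (,-injectiveʳ eq))) (m+1+n≢m _ ∘ sym)

edgeLabel-injective : ∀ {n e e′} → ConeEdge n e → ConeEdge n e′ → edgeLabel n e ≈ₛ edgeLabel n e′ → e ≡ e′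
edgeLabel-injective c c′ c≈c′ =
  edgeCode-injective c c′ (bounds-transport c≈c′ (bounds-edgeLabel c) (bounds-edgeLabel c′))

module Construction (m n : ℕ) where

  F : Labelling (cone m n)
  F u = coneLabel n (toℕ u)

  F-weakIASI : IsWeakIASI (cone m n) F
  F-weakIASI = record
    { iasi = record
      { nonempty = λ v → coneLabel-nonempty n (toℕ v)
      ; injective = λ u v Fu≈Fv → Fin.toℕ-injective (coneLabel-injective n _ _ Fu≈Fv)
      ; edgeInjective = λ { (_ , _) (_ , _) e∈E e′∈E F⁺e≈F⁺e′ →
          toℕ²-injective (edgeLabel-injective (∈-edges-cone⁻ {m} {n} e∈E) (∈-edges-cone⁻ {m} {n} e′∈E) F⁺e≈F⁺e′) }
      }
    ; weak = λ u v uv∈E → edgeLabel-weak (∈-edges-cone⁻ {m} {n} uv∈E)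
    }

  ∈monoEdges⇒cycleEdge : ∀ {u v} → (u , v) ∈ monoEdges (cone m n) F → CycleEdge n (toℕ u , toℕ v)
  ∈monoEdges⇒cycleEdge uv∈mono =
    let uv∈E , mono = ∈-filter⁻ (λ e → card (sumLabel (cone m n) F e) ≟ 1) {xs = edges (cone m n)} uv∈mono
    in mono-edgeLabel⇒cycleEdge (∈-edges-cone⁻ {m} {n} uv∈E) mono

  monoCount-F≤n : monoCount (cone m n) F ≤ n
  monoCount-F≤n = begin
    length (monoEdges (cone m n) F)            ≡⟨ length-map toℕ² (monoEdges (cone m n) F) ⟨
    length (map toℕ² (monoEdges (cone m n) F)) ≤⟨ ⊆⇒length≤ unique ⊆edgesToNext ⟩
    length (map (edgeToNext n) (upTo n))        ≡⟨ trans (length-map (edgeToNext n) (upTo n)) (length-upTo n) ⟩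
    n                                           ∎
    where
    open ≤-Reasoning
    unique : Unique (map toℕ² (monoEdges (cone m n) F))
    unique = Unique.map⁺ toℕ²-injective (Unique.filter⁺ _ (edges-unique (cone m n)))
    ⊆edgesToNext : map toℕ² (monoEdges (cone m n) F) ⊆ map (edgeToNext n) (upTo n)
    ⊆edgesToNext z∈ with ∈-map⁻ toℕ² z∈
    ... | _ , e∈mono , refl with cycleEdge⇒edgeToNext (∈monoEdges⇒cycleEdge e∈mono)
    ...   | a , a<n , edgeToNext≡ = subst (_∈ _) edgeToNext≡ (∈-map⁺ (edgeToNext n) (∈-upTo⁺ a<n))

-- Every weak IASI has n mono-indexed edges

module LowerBound {m n : ℕ} (1<m : 1 < m) (2<n : 2 < n) {f : Labelling (cone m n)} (weakIASI : IsWeakIASI (cone m n) f) where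

  open ConeVertices m n

  1<n : 1 < n
  1<n = <-trans (n<1+n 1) 2<n

  0<m : 0 < m
  0<m = <-trans z<s 1<m

  hub₀ hub₁ : Fin (n + m)
  hub₀ = hub 0 0<m
  hub₁ = hub 1 1<m

  mono⊎next-mono : ∀ {a} (a<n : a < n) → Mono (f (cyc a a<n)) ⊎ Mono (f (cyc (next n a) (next<n a<n)))
  mono⊎next-mono a<n with next-adjacent 1<n a<n
  ... | inj₁ c = weak⇒mono-endpoint weakIASI (cycle-edge c a<n (next<n a<n))
  ... | inj₂ c = Sum.swap (weak⇒mono-endpoint weakIASI (cycle-edge c (next<n a<n) a<n))

  nonMono-hub⇒mono-cycle : ∀ {k} .{k<m : k < m} → ¬ Mono (f (hub k k<m)) → ∀ {a} (a<n : a < n) → Mono (f (cyc a a<n))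
  nonMono-hub⇒mono-cycle {k<m = k<m} ¬mono-hub a<n with weak⇒mono-endpoint weakIASI (spoke-edge a<n k<m)
  ... | inj₁ mono-a = mono-a
  ... | inj₂ mono-hub = contradiction mono-hub ¬mono-hub

  mono-cycle⇒n≤ : (∀ {a} (a<n : a < n) → Mono (f (cyc a a<n))) → n ≤ monoCount (cone m n) f
  mono-cycle⇒n≤ mono-cycle = injective⇒≤length edgeFrom edgeFrom-injective edgeFrom∈mono
    where
    edgeFrom : Fin n → Edge (cone m n)
    edgeFrom i = liftCycleEdge (edgeToNext-cycleEdge 1<n (Fin.toℕ<n i))

    edgeFrom-injective : Injective _≡_ _≡_ edgeFrom
    edgeFrom-injective {i} {j} eq = Fin.toℕ-injective (edgeToNext-injective 2<n (Fin.toℕ<n i) (Fin.toℕ<n j) (begin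
      edgeToNext n (toℕ i) ≡⟨ toℕ²-liftCycleEdge (edgeToNext-cycleEdge 1<n (Fin.toℕ<n i)) ⟨
      toℕ² (edgeFrom i)    ≡⟨ cong toℕ² eq ⟩
      toℕ² (edgeFrom j)    ≡⟨ toℕ²-liftCycleEdge (edgeToNext-cycleEdge 1<n (Fin.toℕ<n j)) ⟩
      edgeToNext n (toℕ j) ∎))
      where open ≡-Reasoning

    edgeFrom∈mono : ∀ i → edgeFrom i ∈ monoEdges (cone m n) f
    edgeFrom∈mono i =
      let c = edgeToNext-cycleEdge 1<n (Fin.toℕ<n i)
          a<n , b<n = cycleEdge-endpoints<n c
      in mono-endpoints⇒∈monoEdges weakIASI (cycle-edge c a<n b<n) (mono-cycle a<n) (mono-cycle b<n)

  mono-hubs⇒n≤ : Mono (f hub₀) → Mono (f hub₁) → n ≤ monoCount (cone m n) f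
  mono-hubs⇒n≤ mono-hub₀ mono-hub₁ = injective⇒≤length charged charged-injective charged∈mono
    where
    spokeFrom : ∀ {a} (a<n : a < n) → Dec (Mono (f (cyc a a<n))) → Edge (cone m n)
    spokeFrom {a} a<n (yes _) = cyc a a<n , hub₀
    spokeFrom {a} a<n (no _) = cyc (next n a) (next<n a<n) , hub₁

    spokeFrom∈mono : ∀ {a} (a<n : a < n) d → spokeFrom a<n d ∈ monoEdges (cone m n) f
    spokeFrom∈mono a<n (yes mono-a) = mono-endpoints⇒∈monoEdges weakIASI (spoke-edge a<n 0<m) mono-a mono-hub₀
    spokeFrom∈mono a<n (no ¬mono-a) with mono⊎next-mono a<n
    ... | inj₁ mono-a = contradiction mono-a ¬mono-a
    ... | inj₂ mono-next = mono-endpoints⇒∈monoEdges weakIASI (spoke-edge (next<n a<n) 1<m) mono-next mono-hub₁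

    hub₀≢hub₁ : hub₀ ≢ hub₁
    hub₀≢hub₁ eq with hub-injective 0<m 1<m eq
    ... | ()

    spokeFrom-injective : ∀ {a b} (a<n : a < n) (b<n : b < n) da db → spokeFrom a<n da ≡ spokeFrom b<n db → a ≡ b
    spokeFrom-injective a<n b<n (yes _) (yes _) eq = cyc-injective a<n b<n (,-injectiveˡ eq)
    spokeFrom-injective a<n b<n (no _) (no _) eq =
      next-injective a<n b<n (cyc-injective (next<n a<n) (next<n b<n) (,-injectiveˡ eq))
    spokeFrom-injective a<n b<n (yes _) (no _) eq = contradiction (,-injectiveʳ eq) hub₀≢hub₁
    spokeFrom-injective a<n b<n (no _) (yes _) eq = contradiction (sym (,-injectiveʳ eq)) hub₀≢hub₁

    charged : Fin n → Edge (cone m n)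
    charged i = spokeFrom (Fin.toℕ<n i) (card (f (cyc (toℕ i) (Fin.toℕ<n i))) ≟ 1)

    charged-injective : Injective _≡_ _≡_ charged
    charged-injective eq = Fin.toℕ-injective (spokeFrom-injective _ _ _ _ eq)

    charged∈mono : ∀ i → charged i ∈ monoEdges (cone m n) f
    charged∈mono i = spokeFrom∈mono _ _

  n≤monoCount : n ≤ monoCount (cone m n) f
  n≤monoCount with card (f hub₀) ≟ 1 | card (f hub₁) ≟ 1
  ... | yes mono-hub₀ | yes mono-hub₁ = mono-hubs⇒n≤ mono-hub₀ mono-hub₁
  ... | no ¬mono-hub₀ | _ = mono-cycle⇒n≤ (nonMono-hub⇒mono-cycle {k<m = 0<m} ¬mono-hub₀)
  ... | _ | no ¬mono-hub₁ = mono-cycle⇒n≤ (nonMono-hub⇒mono-cycle {k<m = 1<m} ¬mono-hub₁)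

mainTheorem2 : (m n : ℕ) → 1 < m → 2 < n → IsSparingNumber (cone m n) n
mainTheorem2 m n 1<m 2<n =
  (F , F-weakIASI , ≤-antisym monoCount-F≤n (LowerBound.n≤monoCount 1<m 2<n F-weakIASI)) ,
  λ f weakIASI → LowerBound.n≤monoCount 1<m 2<n weakIASI
  where open Construction m n
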